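{- Let $G$ be a graph and $\kappa$ an integer, and let $G'$, $A$, $B$ be constructed from $G$ as in the context. If there exists a token jumping reconfiguration sequence from $A$ to $B$ in $G'$ consisting of at most $|V(G)|+\kappa$ token jumps, then $G$ has a vertex cover of size at most $\kappa$.
   Context: Construction: $G'$ is obtained from a copy of $G$ by adding, for each $v\in V(G)$, two new vertices $s_v,t_v$ with edges $\{s_v,v\},\{v,t_v\}$, and adding two new vertices $s,t$ with edges $\{s,s_v\}$ and $\{t_v,t\}$ for all $v\in V(G)$. Set $A=\{s_v: v\in V(G)\}$ and $B=\{t_v: v\in V(G)\}$ (these are minimum $s$-$t$-separators of $G'$). An $s$-$t$-separator is a set $S\subseteq V(G')\setminus\{s,t\}$ such that $s,t$ lie in different components of $G'-S$; minimum means of minimum size. A token jumping reconfiguration sequence from $A$ to $B$ is a sequence $A=S_1,\dots,S_r=B$ of minimum $s$-$t$-separators with $S_i=(S_{i-1}\setminus\{v\})\cup\{u\}$, $v\in S_{i-1}$, $u\in V(G')\setminus S_{i-1}$ for each $i\ge2$; it consists of $r-1$ jumps. -}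

module Defs where

open import Data.Nat using (ℕ; zero; suc; _≤_)
open import Data.Fin using (Fin)
open import Data.Bool using (Bool; true; false)
open import Data.List using (List; []; _∷_; _++_; map; filter; length)
open import Data.Sum using (_⊎_)
open import Data.Product using (Σ; _×_)
open import Relation.Nullary using (¬_)
open import Relation.Binary.PropositionalEquality using (_≡_; _≢_)

record Graph : Set where
  field
    n      : ℕ
    adj    : Fin n → Fin n → Bool
    sym    : ∀ u v → adj u v ≡ adj v u
    irrefl : ∀ v → adj v v ≡ false
open Graph public

-- Vertex sets are Boolean predicates on a finite type; cardinality counts
-- the elements of an explicit duplicate-free enumeration.
allFin : (n : ℕ) → List (Fin n)
allFin n = Data.List.allFin n

countTrue : {A : Set} → (A → Bool) → List A → ℕ
countTrue S [] = 0
countTrue S (x ∷ xs) with S x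
... | true  = suc (countTrue S xs)
... | false = countTrue S xs

IsVertexCover : (G : Graph) → (Fin (n G) → Bool) → Set
IsVertexCover G C = ∀ u v → adj G u v ≡ true → (C u ≡ true) ⊎ (C v ≡ true)

sizeG : (G : Graph) → (Fin (n G) → Bool) → ℕ
sizeG G C = countTrue C (allFin (n G))

data V' (m : ℕ) : Set where
  orig : Fin m → V' m
  sv   : Fin m → V' m
  tv   : Fin m → V' m
  s    : V' m
  t    : V' m

allV' : (m : ℕ) → List (V' m)
allV' m = map orig (allFin m) ++ map sv (allFin m) ++ map tv (allFin m) ++ (s ∷ t ∷ [])

-- Edges of G' (one orientation each)
data E' (G : Graph) : V' (n G) → V' (n G) → Set where
  e-G  : ∀ u v → adj G u v ≡ true → E' G (orig u) (orig v)
  e-sv : ∀ v → E' G (sv v) (orig v)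
  e-tv : ∀ v → E' G (orig v) (tv v)
  e-s  : ∀ v → E' G s (sv v)
  e-t  : ∀ v → E' G (tv v) t

Adj' : (G : Graph) → V' (n G) → V' (n G) → Set
Adj' G x y = E' G x y ⊎ E' G y x

VSet : Graph → Set
VSet G = V' (n G) → Bool

card : (G : Graph) → VSet G → ℕ
card G S = countTrue S (allV' (n G))

data Walk (G : Graph) (S : VSet G) : V' (n G) → V' (n G) → Set where
  here : ∀ {x} → S x ≡ false → Walk G S x x
  cons : ∀ {x y z} → S x ≡ false → Adj' G x y → Walk G S y z → Walk G S x z

IsSep : (G : Graph) → VSet G → Set
IsSep G S = (S s ≡ false) × (S t ≡ false) × ¬ Walk G S s t

IsMinSep : (G : Graph) → VSet G → Set
IsMinSep G S = IsSep G S × (∀ T → IsSep G T → card G S ≤ card G T)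

setA : (G : Graph) → VSet G
setA G (sv _) = true
setA G _      = false

setB : (G : Graph) → VSet G
setB G (tv _) = true
setB G _      = false

Jump : (G : Graph) → VSet G → VSet G → Set
Jump G S S' = Σ (V' (n G)) λ v → Σ (V' (n G)) λ u →
  (S v ≡ true) × (S u ≡ false) × (S' v ≡ false) × (S' u ≡ true) ×
  (∀ x → x ≢ u → x ≢ v → S' x ≡ S x)

data TJSeq (G : Graph) : VSet G → VSet G → ℕ → Set where
  done : ∀ {S T} → IsMinSep G S → (∀ x → S x ≡ T x) → TJSeq G S T 0
  step : ∀ {S S' T k} → IsMinSep G S → Jump G S S' → TJSeq G S' T k →
         TJSeq G S T (suc k)

{-# OPTIONS --safe #-}
module Submission where

-- A minimum s-t-separator of G' has |V(G)| vertices (as A does) and meets each of the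
-- |V(G)| internally disjoint paths s sᵥ v tᵥ t, so it holds exactly one token on each of
-- them: it is described by a layer A, G or B per vertex, and a jump moves one token.
-- Reading the sequence backwards we mark a vertex unless its token jumps straight from
-- A to B; such a jump of w while a neighbour z still sits in A would leave the path
-- s s_w w z t_z t open, so the marked vertices cover every edge among the vertices
-- still in A. The cost of a vertex (2 or 1 in A when marked or not, 1 in G, 0 in B)
-- drops by at most one per jump, so k is at least the total cost at A, |V(G)| + |C|.

open import Defs hiding (sym)
open import Data.Nat using (ℕ)
open import Data.Integer using (ℤ; +_; _+_; _≤_)
open import Data.Product using (Σ; _×_)
open import Data.Bool using (Bool)
open import Data.Fin using (Fin)

open import Data.Nat as ℕ using (zero; suc; z≤n; s≤s)
import Data.Nat.Properties as ℕ
import Data.Integer as ℤ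
import Data.Integer.Properties as ℤ
open import Data.Fin using (zero; suc; punchIn)
open import Data.Fin.Properties using (punchInᵢ≢i; _≟_)
open import Data.Bool using (true; false)
open import Data.Bool.Properties using (not-¬; ¬-not)
open import Data.List using ([]; _∷_; _++_; map; tabulate)
open import Data.List.Properties using (map-tabulate)
open import Data.Vec.Functional using (removeAt; updateAt)
open import Data.Vec.Functional.Properties using (updateAt-updates; updateAt-minimal)
open import Data.Product using (_,_; proj₁; proj₂)
open import Data.Sum as Sum using (_⊎_; inj₁; inj₂)
open import Data.Empty using (⊥; ⊥-elim)
open import Function using (_∘_; id; const)
open import Relation.Nullary using (yes; no; contradiction)
open import Relation.Binary.PropositionalEquality

open import Algebra.Properties.CommutativeMonoid.Sum ℕ.+-0-commutativeMonoid
  using (sum; sum-cong-≗; ∑-distrib-+; sum-remove; sum-replicate-zero)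

sum-mono-≤ : ∀ {m} {f g : Fin m → ℕ} → (∀ i → f i ℕ.≤ g i) → sum f ℕ.≤ sum g
sum-mono-≤ {zero}  f≤g = z≤n
sum-mono-≤ {suc m} f≤g = ℕ.+-mono-≤ (f≤g zero) (sum-mono-≤ (f≤g ∘ suc))

sum-ones : ∀ m → sum {m} (λ _ → 1) ≡ m
sum-ones zero    = refl
sum-ones (suc m) = cong suc (sum-ones m)

sum-positive-≥ : ∀ {m} {f : Fin m → ℕ} → (∀ i → 1 ℕ.≤ f i) → m ℕ.≤ sum f
sum-positive-≥ {m} {f} 1≤f = subst (ℕ._≤ sum f) (sum-ones m) (sum-mono-≤ 1≤f)

sum-positive-≤⇒≡1 : ∀ {m} {f : Fin m → ℕ} → (∀ i → 1 ℕ.≤ f i) → sum f ℕ.≤ m →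
                    ∀ i → f i ≡ 1
sum-positive-≤⇒≡1 {suc m} {f} 1≤f ∑f≤m i = ℕ.≤-antisym fᵢ≤1 (1≤f i)
  where
  open ℕ.≤-Reasoning
  fᵢ≤1 : f i ℕ.≤ 1
  fᵢ≤1 = ℕ.+-cancelʳ-≤ m (f i) 1 (begin
    f i ℕ.+ m                   ≤⟨ ℕ.+-monoʳ-≤ (f i) (sum-positive-≥ (1≤f ∘ punchIn i)) ⟩
    f i ℕ.+ sum (removeAt f i)  ≡⟨ sum-remove f ⟨
    sum f                       ≤⟨ ∑f≤m ⟩
    suc m                       ∎)

sum-update-≤ : ∀ {m} {f g : Fin m → ℕ} i → (∀ j → j ≢ i → f j ≡ g j) →
               f i ℕ.≤ suc (g i) → sum f ℕ.≤ suc (sum g)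
sum-update-≤ {suc m} {f} {g} i f≡g fᵢ≤ = begin
  sum f                               ≡⟨ sum-remove f ⟩
  f i ℕ.+ sum (removeAt f i)          ≡⟨ cong (f i ℕ.+_) (sum-cong-≗ (λ j → f≡g _ (punchInᵢ≢i i j))) ⟩
  f i ℕ.+ sum (removeAt g i)          ≤⟨ ℕ.+-monoˡ-≤ _ fᵢ≤ ⟩
  suc (g i ℕ.+ sum (removeAt g i))    ≡⟨ cong suc (sum-remove g) ⟨
  suc (sum g)                         ∎
  where open ℕ.≤-Reasoning

𝟙 : Bool → ℕ
𝟙 true  = 1
𝟙 false = 0

countTrue-++ : ∀ {A : Set} (P : A → Bool) xs ys →
               countTrue P (xs ++ ys) ≡ countTrue P xs ℕ.+ countTrue P ys
countTrue-++ P []       ys = refl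
countTrue-++ P (x ∷ xs) ys with P x
... | true  = cong suc (countTrue-++ P xs ys)
... | false = countTrue-++ P xs ys

countTrue-tabulate : ∀ {A : Set} (P : A → Bool) {m} (f : Fin m → A) →
                     countTrue P (tabulate f) ≡ sum (𝟙 ∘ P ∘ f)
countTrue-tabulate P {zero}  f = refl
countTrue-tabulate P {suc m} f with P (f zero)
... | true  = cong suc (countTrue-tabulate P (f ∘ suc))
... | false = countTrue-tabulate P (f ∘ suc)

countTrue-map-allFin : ∀ {A : Set} (P : A → Bool) {m} (f : Fin m → A) →
                       countTrue P (map f (allFin m)) ≡ sum (𝟙 ∘ P ∘ f)
countTrue-map-allFin P f = trans (cong (countTrue P) (map-tabulate id f)) (countTrue-tabulate P f)

+-cancelˡ-≤ : ∀ i {j k} → i + j ≤ i + k → j ≤ k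
+-cancelˡ-≤ i {j} {k} i+j≤i+k = subst₂ _≤_ (cancel j) (cancel k) (ℤ.+-monoʳ-≤ (ℤ.- i) i+j≤i+k)
  where
  cancel : ∀ x → ℤ.- i + (i + x) ≡ x
  cancel x = trans (sym (ℤ.+-assoc (ℤ.- i) i x))
                   (trans (cong (_+ x) (ℤ.+-inverseˡ i)) (ℤ.+-identityˡ x))

data Layer : Set where
  inA inG inB : Layer

at : ∀ {m} → Layer → Fin m → V' m
at inA = sv
at inG = orig
at inB = tv

at-injective : ∀ {m} {i j} {v w : Fin m} → at i v ≡ at j w → v ≡ w
at-injective {i = inA} {inA} refl = refl
at-injective {i = inG} {inG} refl = refl
at-injective {i = inB} {inB} refl = refl
at-injective {i = inA} {inG} ()
at-injective {i = inA} {inB} ()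
at-injective {i = inG} {inA} ()
at-injective {i = inG} {inB} ()
at-injective {i = inB} {inA} ()
at-injective {i = inB} {inG} ()

module _ (G : Graph) where

  private
    m : ℕ
    m = n G

  column : VSet G → Fin m → ℕ
  column S v = 𝟙 (S (orig v)) ℕ.+ (𝟙 (S (sv v)) ℕ.+ 𝟙 (S (tv v)))

  card≡∑column : ∀ {S} → S s ≡ false → S t ≡ false → card G S ≡ sum (column S)
  card≡∑column {S} Sₛ Sₜ = begin
    card G S
      ≡⟨ countTrue-++ S (map orig (allFin m)) _ ⟩
    countTrue S (map orig (allFin m)) ℕ.+ countTrue S (map sv (allFin m) ++ _)
      ≡⟨ cong (countTrue S (map orig (allFin m)) ℕ.+_)
              (trans (countTrue-++ S (map sv (allFin m)) _)
                     (cong (countTrue S (map sv (allFin m)) ℕ.+_) (countTrue-++ S (map tv (allFin m)) _))) ⟩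
    countTrue S (map orig (allFin m)) ℕ.+ (countTrue S (map sv (allFin m)) ℕ.+
      (countTrue S (map tv (allFin m)) ℕ.+ countTrue S (s ∷ t ∷ [])))
      ≡⟨ cong₂ ℕ._+_ (countTrue-map-allFin S orig)
           (cong₂ ℕ._+_ (countTrue-map-allFin S sv)
             (trans (cong₂ ℕ._+_ (countTrue-map-allFin S tv) s,t∉S) (ℕ.+-identityʳ _))) ⟩
    sum (𝟙 ∘ S ∘ orig) ℕ.+ (sum (𝟙 ∘ S ∘ sv) ℕ.+ sum (𝟙 ∘ S ∘ tv))
      ≡⟨ trans (cong (sum (𝟙 ∘ S ∘ orig) ℕ.+_) (sym (∑-distrib-+ (𝟙 ∘ S ∘ sv) (𝟙 ∘ S ∘ tv))))
               (sym (∑-distrib-+ (𝟙 ∘ S ∘ orig) _)) ⟩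
    sum (column S)
      ∎
    where
    open ≡-Reasoning
    s,t∉S : countTrue S (s ∷ t ∷ []) ≡ 0
    s,t∉S rewrite Sₛ | Sₜ = refl

  card-setA : card G (setA G) ≡ m
  card-setA = trans (card≡∑column refl refl) (sum-ones m)

  setA-isSep : IsSep G (setA G)
  setA-isSep = refl , refl , λ { (cons _ (inj₁ (e-s v)) (cons () _ _)) ; (cons _ (inj₂ ()) _) }

  minSep-card-≤ : ∀ {S} → IsMinSep G S → card G S ℕ.≤ m
  minSep-card-≤ {S} (_ , minimal) =
    subst (card G S ℕ.≤_) card-setA (minimal (setA G) setA-isSep)

  column-positive : ∀ {S} → IsSep G S → ∀ v → 1 ℕ.≤ column S v
  column-positive {S} (Sₛ , Sₜ , no-path) v
    with S (orig v) in Sᵥ | S (sv v) in Sₐ | S (tv v) in Sᵦ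
  ... | true  | _     | _     = s≤s z≤n
  ... | false | true  | _     = s≤s z≤n
  ... | false | false | true  = s≤s z≤n
  ... | false | false | false = ⊥-elim (no-path
          (cons Sₛ (inj₁ (e-s v)) (cons Sₐ (inj₁ (e-sv v)) (cons Sᵥ (inj₁ (e-tv v))
          (cons Sᵦ (inj₁ (e-t v)) (here Sₜ))))))

  record Placement (S : VSet G) (π : Fin m → Layer) : Set where
    field
      occupied : ∀ v → S (at (π v) v) ≡ true
      unique   : ∀ i v → S (at i v) ≡ true → i ≡ π v

    vacant : ∀ {i j} v → π v ≡ j → i ≢ j → S (at i v) ≡ false
    vacant {i} v refl i≢πv = ¬-not (i≢πv ∘ unique i v)

  open Placement

  column≡1⇒unique-layer : ∀ S v → column S v ≡ 1 →
    Σ Layer λ i → S (at i v) ≡ true × (∀ j → S (at j v) ≡ true → j ≡ i)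
  column≡1⇒unique-layer S v column≡1
    with S (orig v) in Sᵥ | S (sv v) in Sₐ | S (tv v) in Sᵦ | column≡1
  ... | true  | false | false | _ = inG , Sᵥ , λ
    { inA Sₐ′ → contradiction Sₐ′ (not-¬ Sₐ) ; inG _ → refl ; inB Sᵦ′ → contradiction Sᵦ′ (not-¬ Sᵦ) }
  ... | false | true  | false | _ = inA , Sₐ , λ
    { inA _ → refl ; inG Sᵥ′ → contradiction Sᵥ′ (not-¬ Sᵥ) ; inB Sᵦ′ → contradiction Sᵦ′ (not-¬ Sᵦ) }
  ... | false | false | true  | _ = inB , Sᵦ , λ
    { inA Sₐ′ → contradiction Sₐ′ (not-¬ Sₐ) ; inG Sᵥ′ → contradiction Sᵥ′ (not-¬ Sᵥ) ; inB _ → refl }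
  ... | true  | true  | _     | ()
  ... | true  | false | true  | ()
  ... | false | true  | true  | ()
  ... | false | false | false | ()

  minSep-placement : ∀ {S} → IsMinSep G S → Σ (Fin m → Layer) (Placement S)
  minSep-placement {S} minS@(sepS@(Sₛ , Sₜ , _) , _) =
    proj₁ ∘ layer ,
    record { occupied = proj₁ ∘ proj₂ ∘ layer ; unique = λ i v → proj₂ (proj₂ (layer v)) i }
    where
    column≡1 : ∀ v → column S v ≡ 1
    column≡1 = sum-positive-≤⇒≡1 (column-positive sepS)
                 (subst (ℕ._≤ m) (card≡∑column Sₛ Sₜ) (minSep-card-≤ minS))
    layer : ∀ v → Σ Layer λ i → S (at i v) ≡ true × (∀ j → S (at j v) ≡ true → j ≡ i)
    layer v = column≡1⇒unique-layer S v (column≡1 v)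

  setA-placement : Placement (setA G) (const inA)
  setA-placement = record
    { occupied = λ _ → refl ; unique = λ { inA _ _ → refl ; inG _ () ; inB _ () } }

  tjSeq-head : ∀ {S T k} → TJSeq G S T k → IsMinSep G S
  tjSeq-head (done minS _)   = minS
  tjSeq-head (step minS _ _) = minS

  sep-vertex-at : ∀ {S} → IsSep G S → ∀ {x} → S x ≡ true →
                  Σ Layer λ i → Σ (Fin m) λ w → x ≡ at i w
  sep-vertex-at _ {orig w} _ = inG , w , refl
  sep-vertex-at _ {sv w}   _ = inA , w , refl
  sep-vertex-at _ {tv w}   _ = inB , w , refl
  sep-vertex-at (Sₛ , _ , _) {s} Sₓ = contradiction Sₓ (not-¬ Sₛ)
  sep-vertex-at (_ , Sₜ , _) {t} Sₓ = contradiction Sₓ (not-¬ Sₜ)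

  jump-moves-one-token : ∀ {S S′ π π′} → IsSep G S → Placement S π → Placement S′ π′ →
    Jump G S S′ → Σ (Fin m) λ w → π′ w ≢ π w × (∀ x → x ≢ w → π′ x ≡ π x)
  jump-moves-one-token {S} {S′} {π} {π′} sepS P P′ (v , u , Sᵥ , Sᵤ , S′ᵥ , _ , unchanged)
    with sep-vertex-at sepS Sᵥ
  ... | i , w , refl = w , moved , stays
    where
    moved : π′ w ≢ π w
    moved π′w≡πw = contradiction
      (subst (λ j → S′ (at j w) ≡ true) (trans π′w≡πw (sym (unique P i w Sᵥ))) (occupied P′ w))
      (not-¬ S′ᵥ)
    stays : ∀ x → x ≢ w → π′ x ≡ π x
    stays x x≢w =
      sym (unique P′ (π x) x (trans (unchanged (at (π x) x) ≢u (x≢w ∘ at-injective)) (occupied P x)))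
      where
      ≢u : at (π x) x ≢ u
      ≢u refl = contradiction (occupied P x) (not-¬ Sᵤ)

  no-A-B-edge : ∀ {S π} → IsSep G S → Placement S π → ∀ {w z} → adj G w z ≡ true →
                π w ≡ inB → π z ≡ inA → ⊥
  no-A-B-edge (Sₛ , Sₜ , no-path) P {w} {z} wz πw≡B πz≡A = no-path
    (cons Sₛ (inj₁ (e-s w)) (cons (vacant P w πw≡B λ ()) (inj₁ (e-sv w))
    (cons (vacant P w πw≡B λ ()) (inj₁ (e-G w z wz)) (cons (vacant P z πz≡A λ ()) (inj₁ (e-tv z))
    (cons (vacant P z πz≡A λ ()) (inj₁ (e-t z)) (here Sₜ))))))

  cost : Bool → Layer → ℕ
  cost c inA = suc (𝟙 c)
  cost _ inG = 1
  cost _ inB = 0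

  potential : (Fin m → Bool) → (Fin m → Layer) → ℕ
  potential C π = sum (λ v → cost (C v) (π v))

  CoversA : (Fin m → Bool) → (Fin m → Layer) → Set
  CoversA C π = ∀ u v → adj G u v ≡ true → π u ≡ inA → π v ≡ inA → C u ≡ true ⊎ C v ≡ true

  viaMiddle : Layer → Layer → Bool
  viaMiddle inA inB = false
  viaMiddle _   _   = true

  viaMiddle-true : ∀ i {i′} → i′ ≢ inB → viaMiddle i i′ ≡ true
  viaMiddle-true inA {inA} _    = refl
  viaMiddle-true inA {inG} _    = refl
  viaMiddle-true inA {inB} i′≢B = contradiction refl i′≢B
  viaMiddle-true inG            _ = refl
  viaMiddle-true inB            _ = refl

  cost-jump : ∀ i i′ c → i′ ≢ i → cost (viaMiddle i i′) i ℕ.≤ suc (cost c i′)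
  cost-jump inA inA _ moved = contradiction refl moved
  cost-jump inA inG _ _     = ℕ.≤-refl
  cost-jump inA inB _ _     = ℕ.≤-refl
  cost-jump inG _   _ _     = s≤s z≤n
  cost-jump inB _   _ _     = z≤n

  module _ {π π′ : Fin m → Layer} (C′ : Fin m → Bool) (w : Fin m)
           (moved : π′ w ≢ π w) (stays : ∀ x → x ≢ w → π′ x ≡ π x) where

    private
      C : Fin m → Bool
      C = updateAt C′ w (const (viaMiddle (π w) (π′ w)))

      marked : ∀ {S′} → IsSep G S′ → Placement S′ π′ → ∀ {z} → adj G w z ≡ true → π z ≡ inA →
               C w ≡ true
      marked sepS′ P′ {z} wz πz≡A = trans (updateAt-updates w C′) (viaMiddle-true (π w)
        (λ π′w≡B → no-A-B-edge sepS′ P′ wz π′w≡B (trans (stays z z≢w) πz≡A)))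
        where
        z≢w : z ≢ w
        z≢w refl = contradiction (trans (sym wz) (irrefl G w)) λ ()

    potential-after-jump : potential C π ℕ.≤ suc (potential C′ π′)
    potential-after-jump = sum-update-≤ w
      (λ x x≢w → cong₂ cost (updateAt-minimal x w C′ x≢w) (sym (stays x x≢w)))
      (subst (λ c → cost c (π w) ℕ.≤ _) (sym (updateAt-updates w C′))
             (cost-jump (π w) (π′ w) (C′ w) moved))

    covers-after-jump : ∀ {S′} → IsSep G S′ → Placement S′ π′ → CoversA C′ π′ → CoversA C π
    covers-after-jump sepS′ P′ covers′ u v uv πu≡A πv≡A with u ≟ w | v ≟ w
    ... | yes refl | _        = inj₁ (marked sepS′ P′ uv πv≡A)
    ... | no _     | yes refl = inj₂ (marked sepS′ P′ (trans (Graph.sym G v u) uv) πu≡A)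
    ... | no u≢w   | no v≢w   =
      Sum.map (trans (updateAt-minimal u w C′ u≢w)) (trans (updateAt-minimal v w C′ v≢w))
              (covers′ u v uv (trans (stays u u≢w) πu≡A) (trans (stays v v≢w) πv≡A))

  cover-from-sequence : ∀ {S π k} → TJSeq G S (setB G) k → Placement S π →
                        Σ (Fin m → Bool) λ C → CoversA C π × potential C π ℕ.≤ k
  cover-from-sequence {π = π} (done _ S≈B) P =
    const false , (λ u _ _ πu≡A _ → contradiction (trans (sym (allB u)) πu≡A) λ ()) ,
    ℕ.≤-reflexive (trans (sum-cong-≗ (cong (cost false) ∘ allB)) (sum-replicate-zero m))
    where
    allB : ∀ v → π v ≡ inB
    allB v = sym (unique P inB v (S≈B (tv v)))
  cover-from-sequence {π = π} (step minS jump rest) P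
    with minSep-placement (tjSeq-head rest)
  ... | π′ , P′ with cover-from-sequence rest P′ | jump-moves-one-token (proj₁ minS) P P′ jump
  ... | C′ , covers′ , potential′≤k | w , moved , stays =
    _ , covers-after-jump C′ w moved stays (proj₁ (tjSeq-head rest)) P′ covers′ ,
    ℕ.≤-trans (potential-after-jump C′ w moved stays) (s≤s potential′≤k)

  potential-allA : ∀ C → potential C (const inA) ≡ m ℕ.+ sizeG G C
  potential-allA C = begin
    sum (λ v → suc (𝟙 (C v)))             ≡⟨ ∑-distrib-+ (const 1) (𝟙 ∘ C) ⟩
    sum {m} (const 1) ℕ.+ sum (𝟙 ∘ C)     ≡⟨ cong₂ ℕ._+_ (sum-ones m) (sym (countTrue-tabulate C id)) ⟩
    m ℕ.+ sizeG G C                       ∎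
    where open ≡-Reasoning

lemma4 : (G : Graph) (κ : ℤ) (k : ℕ) →
    TJSeq G (setA G) (setB G) k → + k ≤ + n G + κ →
    Σ (Fin (n G) → Bool) λ C → IsVertexCover G C × (+ sizeG G C ≤ κ)
lemma4 G κ k seq k≤n+κ with cover-from-sequence G seq (setA-placement G)
... | C , covers , potential≤k =
  C , (λ u v uv → covers u v uv refl refl) , +-cancelˡ-≤ (+ n G) (begin
  + n G + + sizeG G C            ≡⟨ ℤ.pos-+ (n G) (sizeG G C) ⟨
  + (n G ℕ.+ sizeG G C)          ≡⟨ cong +_ (potential-allA G C) ⟨
  + potential G C (const inA)    ≤⟨ ℤ.+≤+ potential≤k ⟩
  + k                            ≤⟨ k≤n+κ ⟩
  + n G + κ                      ∎)
  where open ℤ.≤-Reasoning
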